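{- Let $H$ and $G$ be graphs, where $|V(H)|=n$, $\Delta(H)=\Delta$ and $\delta(G)=\delta$. Let $S$ be a maximum $G$-free subset of $V(H)$, and for each integer $i$ let $n_i(S)$ denote the number of vertices of $V(H)\setminus S$ having exactly $i$ neighbours in $S$. Then \[ n-\frac{\delta n_{\delta}(S)+(\delta+1)n_{\delta+1}(S)+\cdots+\Delta n_{\Delta}(S)}{\delta}\;\leq\; |S|\;\leq\; n-\frac{\delta n_{\delta}(S)+(\delta+1)n_{\delta+1}(S)+\cdots+\Delta n_{\Delta}(S)}{\Delta}.\]
   Context: All graphs are finite, simple and undirected. $\Delta(H)$ denotes the maximum degree of $H$ and $\delta(G)$ the minimum degree of $G$. For $W\subseteq V(H)$, $H[W]$ is the subgraph of $H$ induced by $W$. A subset $S\subseteq V(H)$ is called $G$-free if $H[S]$ contains no subgraph isomorphic to $G$; a maximum $G$-free subset is a $G$-free subset of largest possible cardinality. -}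

module Defs where

open import Data.Nat using (ℕ; zero; suc; _+_; _*_; _∸_; _⊔_; _⊓_; _≡ᵇ_)
open import Data.Bool using (Bool; true; false; not; _∧_)
open import Data.Fin using (Fin)
open import Data.Fin.Subset using (Subset; _∈_; _∉_; _∩_; ∣_∣)
open import Data.Fin.Subset.Properties using (_∈?_)
open import Data.Vec using (tabulate)
open import Data.List using (List; foldr; map; allFin; applyUpTo)
open import Data.Nat.ListAction using (sum)
open import Data.Product using (Σ; _×_)
open import Function.Definitions using (Injective)
open import Relation.Binary.PropositionalEquality using (_≡_)
open import Relation.Nullary.Decidable using (⌊_⌋)

record Graph (n : ℕ) : Set where
  field
    adj   : Fin n → Fin n → Bool
    sym   : ∀ u v → adj u v ≡ adj v u
    irrefl : ∀ v → adj v v ≡ false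
open Graph public

N : ∀ {n} → Graph n → Fin n → Subset n
N H v = tabulate (adj H v)

degree : ∀ {n} → Graph n → Fin n → ℕ
degree H v = ∣ N H v ∣

-- maximum degree Δ(H) (0 for the empty graph)
maxDegree : ∀ {n} → Graph n → ℕ
maxDegree {n} H = foldr _⊔_ 0 (map (degree H) (allFin n))

-- minimum degree δ(G) (0 by convention for the graph with no vertices)
minDegree : ∀ {m} → Graph m → ℕ
minDegree {zero}  G = 0
minDegree {suc k} G = foldr _⊓_ (degree G Fin.zero) (map (degree G) (allFin (suc k)))

-- H[S] contains a subgraph isomorphic to G: an injective map V(G) → S
-- sending edges of G to edges of H.
ContainsCopy : ∀ {m n} → Graph m → Graph n → Subset n → Set
ContainsCopy {m} {n} G H S =
  Σ (Fin m → Fin n) λ f →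
    Injective _≡_ _≡_ f ×
    (∀ i → f i ∈ S) ×
    (∀ i j → adj G i j ≡ true → adj H (f i) (f j) ≡ true)

GFree : ∀ {m n} → Graph m → Graph n → Subset n → Set
GFree G H S = ContainsCopy G H S → Data.Empty.⊥
  where import Data.Empty

MaximumGFree : ∀ {m n} → Graph m → Graph n → Subset n → Set
MaximumGFree {n = n} G H S = GFree G H S × (∀ (T : Subset n) → GFree G H T → ∣ T ∣ Data.Nat.≤ ∣ S ∣)
  where import Data.Nat

nᵢ : ∀ {n} → Graph n → Subset n → ℕ → ℕ
nᵢ H S i = ∣ tabulate (λ v → not ⌊ v ∈? S ⌋ ∧ (∣ N H v ∩ S ∣ ≡ᵇ i)) ∣

-- Σ_{i=a}^{b} f i  (empty sum if b < a)
sumFromTo : ℕ → ℕ → (ℕ → ℕ) → ℕ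
sumFromTo a b f = sum (applyUpTo (λ k → f (a + k)) (suc b ∸ a))

weightedCount : ∀ {n} → Graph n → Subset n → ℕ → ℕ → ℕ
weightedCount H S δ Δ = sumFromTo δ Δ (λ i → i * nᵢ H S i)

{-# OPTIONS --safe #-}
-- Every vertex v outside a maximum G-free set S has at least δ(G) neighbours in S: otherwise
-- S ∪ {v} would still be G-free, since a copy of G inside it must use v, say as the image of i,
-- and would then map the at least δ(G) neighbours of i injectively into N(v) ∩ S.  So every
-- v ∉ S has between δ(G) and Δ(H) neighbours in S.  Grouping the vertices outside S by this
-- number, δ n_δ + … + Δ n_Δ is the sum of these numbers over V(H) ∖ S, which lies between
-- δ (n − |S|) and Δ (n − |S|).
module Submission where

open import Defs hiding (sym)
open import Data.Nat using (ℕ; _*_; _∸_; _≤_)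
open import Data.Fin.Subset using (Subset; ∣_∣)
open import Data.Product using (_×_)

open import Data.Bool using (Bool; true; false; not; _∧_; T)
open import Data.Empty using (⊥-elim)
open import Data.Fin using (Fin; zero; suc; toℕ)
open import Data.Fin.Properties using (any?; suc-injective; 0≢1+n) renaming (_≟_ to _≟ᶠ_)
open import Data.Fin.Subset using (Side; inside; outside; _∈_; _∉_; _⊂_; _∩_; _∪_; _-_; ⁅_⁆; ∁)
open import Data.Fin.Subset.Properties
  using (_∈?_; p─⊥≡p; x∈p∧x≢y⇒x∈p-y; x∈⁅x⁆; x∈⁅y⁆⇒x≡y; p⊆p∪q; x∈p∪q⁺; x∈p∪q⁻; x∈p∩q⁺;
         p⊂q⇒∣p∣<∣q∣; ∣p∩q∣≤∣p∣; ∣∁p∣≡n∸∣p∣)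
open import Data.List using ([]; _∷_; foldr; map; allFin; applyUpTo)
open import Data.List.Membership.Propositional using () renaming (_∈_ to _∈ₗ_)
open import Data.List.Membership.Propositional.Properties using (∈-allFin)
import Data.List.Relation.Unary.Any as Any
open import Data.Nat using (zero; suc; _+_; _<_; _⊓_; _⊔_; _≡ᵇ_; z≤n; s≤s; _≤?_)
import Data.Nat.ListAction as List
open import Data.Nat.Properties
  using (+-*-semiring; +-identityʳ; +-mono-≤; *-monoˡ-≤; *-zeroʳ; *-identityʳ; ≤-reflexive; ≤-trans;
         <⇒≱; m+[n∸m]≡n; m≤n⇒m≤1+n; m⊓n≤m; m⊓n≤n; m≤m⊔n; m≤n⊔m; module ≤-Reasoning)
open import Algebra.Properties.Semiring.Sum +-*-semiring
  using (sum-syntax; sum-cong-≗; sum-replicate-zero; ∑-comm; *-distribˡ-sum)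
open import Data.Product using (_,_; proj₁; proj₂; ∃)
open import Data.Sum using ([_,_]′; inj₂)
open import Data.Unit using (tt)
open import Data.Vec using ([]; _∷_; tabulate; here; there)
open import Data.Vec.Properties using (tabulate-cong; lookup∘tabulate; []=⇒lookup; lookup⇒[]=)
open import Function using (id; _∘_)
open import Function.Definitions using (Injective)
open import Relation.Binary.PropositionalEquality
open import Relation.Nullary using (Dec; yes; no; contradiction)
open import Relation.Nullary.Decidable using (⌊_⌋; toWitnessFalse)

indicator : Bool → ℕ
indicator true  = 1
indicator false = 0

∣tabulate∣≡∑ : ∀ {n} (h : Fin n → Bool) → ∣ tabulate h ∣ ≡ ∑[ v < n ] indicator (h v)
∣tabulate∣≡∑ {zero}  h = refl
∣tabulate∣≡∑ {suc n} h with h zero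
... | true  = cong suc (∣tabulate∣≡∑ (h ∘ suc))
... | false = ∣tabulate∣≡∑ (h ∘ suc)

∑-mono-≤ : ∀ {n} {f g : Fin n → ℕ} → (∀ i → f i ≤ g i) → ∑[ i < n ] f i ≤ ∑[ i < n ] g i
∑-mono-≤ {zero}  f≤g = z≤n
∑-mono-≤ {suc n} f≤g = +-mono-≤ (f≤g zero) (∑-mono-≤ (f≤g ∘ suc))

*-indicator-mono : ∀ b {x y} → (T b → x ≤ y) → x * indicator b ≤ y * indicator b
*-indicator-mono true  x≤y = *-monoˡ-≤ 1 (x≤y tt)
*-indicator-mono false {x} {y} _ = ≤-reflexive (trans (*-zeroʳ x) (sym (*-zeroʳ y)))

∑-weighted-mono : ∀ {n} (P : Fin n → Bool) {g h : Fin n → ℕ} → (∀ v → T (P v) → g v ≤ h v) →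
  ∑[ v < n ] (g v * indicator (P v)) ≤ ∑[ v < n ] (h v * indicator (P v))
∑-weighted-mono P g≤h = ∑-mono-≤ (λ v → *-indicator-mono (P v) (g≤h v))

sum-applyUpTo : ∀ L (f : ℕ → ℕ) → List.sum (applyUpTo f L) ≡ ∑[ k < L ] f (toℕ k)
sum-applyUpTo zero    f = refl
sum-applyUpTo (suc L) f = cong (f 0 +_) (sum-applyUpTo L (f ∘ suc))

∑-select : ∀ (c : ℕ → ℕ) L a {x} → a ≤ x → x < a + L →
  ∑[ k < L ] (c (a + toℕ k) * indicator (x ≡ᵇ a + toℕ k)) ≡ c x
∑-select c L       (suc a) (s≤s a≤x) (s≤s x<a+L) = ∑-select (c ∘ suc) L a a≤x x<a+L
∑-select c (suc L) zero {zero}  _ _ = begin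
  c 0 * 1 + ∑[ k < L ] (c (suc (toℕ k)) * 0)
    ≡⟨ cong₂ _+_ (*-identityʳ (c 0)) (sum-cong-≗ {L} (*-zeroʳ ∘ c ∘ suc ∘ toℕ)) ⟩
  c 0 + ∑[ k < L ] 0                          ≡⟨ cong (c 0 +_) (sum-replicate-zero L) ⟩
  c 0 + 0                                     ≡⟨ +-identityʳ (c 0) ⟩
  c 0                                         ∎
  where open ≡-Reasoning
∑-select c (suc L) zero {suc x} _ (s≤s x<L) =
  cong₂ _+_ (*-zeroʳ (c 0)) (∑-select (c ∘ suc) L 0 z≤n x<L)

sumFromTo-fibres : ∀ {n} a b (P : Fin n → Bool) (g : Fin n → ℕ) →
  (∀ v → T (P v) → a ≤ g v × g v ≤ b) →
  sumFromTo a b (λ i → i * ∣ tabulate (λ v → P v ∧ (g v ≡ᵇ i)) ∣)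
    ≡ ∑[ v < n ] (g v * indicator (P v))
sumFromTo-fibres {n} a b P g range = begin
  sumFromTo a b (λ i → i * ∣ tabulate (λ v → P v ∧ (g v ≡ᵇ i)) ∣)
    ≡⟨ sum-applyUpTo L _ ⟩
  ∑[ k < L ] ((a + toℕ k) * ∣ tabulate (λ v → P v ∧ (g v ≡ᵇ a + toℕ k)) ∣)
    ≡⟨ sum-cong-≗ {L} (λ k → cong ((a + toℕ k) *_) (∣tabulate∣≡∑ {n} _)) ⟩
  ∑[ k < L ] ((a + toℕ k) * ∑[ v < n ] indicator (P v ∧ (g v ≡ᵇ a + toℕ k)))
    ≡⟨ sum-cong-≗ {L} (λ k → *-distribˡ-sum {n} (a + toℕ k) _) ⟩
  ∑[ k < L ] ∑[ v < n ] ((a + toℕ k) * indicator (P v ∧ (g v ≡ᵇ a + toℕ k)))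
    ≡⟨ ∑-comm {L} {n} _ ⟩
  ∑[ v < n ] ∑[ k < L ] ((a + toℕ k) * indicator (P v ∧ (g v ≡ᵇ a + toℕ k)))
    ≡⟨ sum-cong-≗ {n} fibre ⟩
  ∑[ v < n ] (g v * indicator (P v))
    ∎
  where
  open ≡-Reasoning
  L = suc b ∸ a
  fibre : ∀ v →
    ∑[ k < L ] ((a + toℕ k) * indicator (P v ∧ (g v ≡ᵇ a + toℕ k))) ≡ g v * indicator (P v)
  fibre v with P v | range v
  ... | true  | in-range = trans (∑-select id L a a≤g g<a+L) (sym (*-identityʳ (g v)))
    where
    a≤g = proj₁ (in-range tt)
    g≤b = proj₂ (in-range tt)
    g<a+L : g v < a + L
    g<a+L = subst (g v <_) (sym (m+[n∸m]≡n (m≤n⇒m≤1+n (≤-trans a≤g g≤b)))) (s≤s g≤b)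
  ... | false | _ = begin
    ∑[ k < L ] ((a + toℕ k) * 0)  ≡⟨ sum-cong-≗ {L} (λ k → *-zeroʳ (a + toℕ k)) ⟩
    ∑[ k < L ] 0                  ≡⟨ sum-replicate-zero L ⟩
    0                             ≡⟨ sym (*-zeroʳ (g v)) ⟩
    g v * 0                       ∎

⌊suc∈?∷⌋ : ∀ {n} (x : Fin n) (s : Side) (p : Subset n) → ⌊ suc x ∈? s ∷ p ⌋ ≡ ⌊ x ∈? p ⌋
⌊suc∈?∷⌋ x s p with x ∈? p
... | yes _ = refl
... | no  _ = refl

tabulate-∉≡∁ : ∀ {n} (p : Subset n) → tabulate (λ v → not ⌊ v ∈? p ⌋) ≡ ∁ p
tabulate-∉≡∁ []      = refl
tabulate-∉≡∁ (s ∷ p) = cong₂ _∷_ (head s)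
  (trans (tabulate-cong (λ v → cong not (⌊suc∈?∷⌋ v s p))) (tabulate-∉≡∁ p))
  where
  head : ∀ s → not ⌊ zero ∈? s ∷ p ⌋ ≡ not s
  head inside  = refl
  head outside = refl

∑-const*indicator-∉ : ∀ {n} c (p : Subset n) →
  ∑[ v < n ] (c * indicator (not ⌊ v ∈? p ⌋)) ≡ c * (n ∸ ∣ p ∣)
∑-const*indicator-∉ {n} c p = begin
  ∑[ v < n ] (c * indicator (not ⌊ v ∈? p ⌋))  ≡⟨ *-distribˡ-sum {n} c _ ⟨
  c * ∑[ v < n ] indicator (not ⌊ v ∈? p ⌋)    ≡⟨ cong (c *_) (∣tabulate∣≡∑ {n} _) ⟨
  c * ∣ tabulate (λ v → not ⌊ v ∈? p ⌋) ∣      ≡⟨ cong (λ q → c * ∣ q ∣) (tabulate-∉≡∁ p) ⟩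
  c * ∣ ∁ p ∣                                  ≡⟨ cong (c *_) (∣∁p∣≡n∸∣p∣ p) ⟩
  c * (n ∸ ∣ p ∣)                              ∎
  where open ≡-Reasoning

∣p∣≡1+∣p-x∣ : ∀ {n} {p : Subset n} {x} → x ∈ p → ∣ p ∣ ≡ suc ∣ p - x ∣
∣p∣≡1+∣p-x∣ {p = inside ∷ p} here = cong (suc ∘ ∣_∣) (sym (p─⊥≡p p))
∣p∣≡1+∣p-x∣ {p = inside  ∷ p} (there x∈p) = cong suc (∣p∣≡1+∣p-x∣ x∈p)
∣p∣≡1+∣p-x∣ {p = outside ∷ p} (there x∈p) = ∣p∣≡1+∣p-x∣ x∈p

injective⇒∣p∣≤∣q∣ : ∀ {m n} {f : Fin m → Fin n} → Injective _≡_ _≡_ f →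
  (p : Subset m) {q : Subset n} → (∀ {x} → x ∈ p → f x ∈ q) → ∣ p ∣ ≤ ∣ q ∣
injective⇒∣p∣≤∣q∣ f-inj []            f[p]⊆q = z≤n
injective⇒∣p∣≤∣q∣ f-inj (outside ∷ p) f[p]⊆q =
  injective⇒∣p∣≤∣q∣ (suc-injective ∘ f-inj) p (f[p]⊆q ∘ there)
injective⇒∣p∣≤∣q∣ {f = f} f-inj (inside ∷ p) {q} f[p]⊆q = begin
  suc ∣ p ∣         ≤⟨ s≤s (injective⇒∣p∣≤∣q∣ (suc-injective ∘ f-inj) p f[p]⊆q-f0) ⟩
  suc ∣ q - f zero ∣ ≡⟨ sym (∣p∣≡1+∣p-x∣ (f[p]⊆q here)) ⟩
  ∣ q ∣             ∎
  where
  open ≤-Reasoning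
  f[p]⊆q-f0 : ∀ {x} → x ∈ p → f (suc x) ∈ q - f zero
  f[p]⊆q-f0 x∈p = x∈p∧x≢y⇒x∈p-y (f[p]⊆q (there x∈p)) (0≢1+n ∘ sym ∘ f-inj)

∈-tabulate⁻ : ∀ {n} {h : Fin n → Bool} {x} → x ∈ tabulate h → h x ≡ true
∈-tabulate⁻ {h = h} {x} x∈ = trans (sym (lookup∘tabulate h x)) ([]=⇒lookup x∈)

∈-tabulate⁺ : ∀ {n} {h : Fin n → Bool} {x} → h x ≡ true → x ∈ tabulate h
∈-tabulate⁺ {h = h} {x} hx = lookup⇒[]= x _ (trans (lookup∘tabulate h x) hx)

foldr-⊓-≤ : ∀ {A : Set} (f : A → ℕ) z {xs x} → x ∈ₗ xs → foldr _⊓_ z (map f xs) ≤ f x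
foldr-⊓-≤ f z {y ∷ xs} (Any.here refl) = m⊓n≤m (f y) _
foldr-⊓-≤ f z {y ∷ xs} (Any.there x∈) = ≤-trans (m⊓n≤n (f y) _) (foldr-⊓-≤ f z x∈)

≤-foldr-⊔ : ∀ {A : Set} (f : A → ℕ) z {xs x} → x ∈ₗ xs → f x ≤ foldr _⊔_ z (map f xs)
≤-foldr-⊔ f z {y ∷ xs} (Any.here refl) = m≤m⊔n (f y) _
≤-foldr-⊔ f z {y ∷ xs} (Any.there x∈) = ≤-trans (≤-foldr-⊔ f z x∈) (m≤n⊔m (f y) _)

minDegree≤degree : ∀ {m} (G : Graph m) i → minDegree G ≤ degree G i
minDegree≤degree {suc m} G i = foldr-⊓-≤ (degree G) _ (∈-allFin i)

degree≤maxDegree : ∀ {n} (H : Graph n) v → degree H v ≤ maxDegree H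
degree≤maxDegree H v = ≤-foldr-⊔ (degree H) 0 (∈-allFin v)

copy-in-S∪⁅v⁆⇒minDegree≤∣N∩S∣ : ∀ {m n} (G : Graph m) (H : Graph n) {S v} → GFree G H S →
  ContainsCopy G H (S ∪ ⁅ v ⁆) → minDegree G ≤ ∣ N H v ∩ S ∣
copy-in-S∪⁅v⁆⇒minDegree≤∣N∩S∣ G H {S} {v} S-free (f , f-inj , f∈S∪⁅v⁆ , f-adj) =
  by-cases (any? (λ i → f i ≟ᶠ v))
  where
  f∈S : ∀ j → f j ≢ v → f j ∈ S
  f∈S j fj≢v = [ id , (λ fj∈⁅v⁆ → contradiction (x∈⁅y⁆⇒x≡y v fj∈⁅v⁆) fj≢v) ]′
                 (x∈p∪q⁻ S ⁅ v ⁆ (f∈S∪⁅v⁆ j))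
  by-cases : Dec (∃ λ i → f i ≡ v) → minDegree G ≤ ∣ N H v ∩ S ∣
  by-cases (no v∉f[G]) = ⊥-elim (S-free (f , f-inj , (λ i → f∈S i (v∉f[G] ∘ (i ,_))) , f-adj))
  by-cases (yes (i , fi≡v)) = ≤-trans (minDegree≤degree G i) (injective⇒∣p∣≤∣q∣ f-inj (N G i) nbr)
    where
    nbr : ∀ {j} → j ∈ N G i → f j ∈ N H v ∩ S
    nbr {j} j∈N = x∈p∩q⁺ (∈-tabulate⁺ (subst (λ u → adj H u (f j) ≡ true) fi≡v (f-adj i j ij))
                         , f∈S j fj≢v)
      where
      ij = ∈-tabulate⁻ j∈N
      fj≢v : f j ≢ v
      fj≢v fj≡v with f-inj (trans fj≡v (sym fi≡v))
      ... | refl = contradiction (trans (sym ij) (irrefl G i)) λ ()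

maximum-GFree⇒minDegree≤∣N∩S∣ : ∀ {m n} (G : Graph m) (H : Graph n) {S v} → MaximumGFree G H S →
  v ∉ S → minDegree G ≤ ∣ N H v ∩ S ∣
maximum-GFree⇒minDegree≤∣N∩S∣ G H {S} {v} (S-free , S-maximum) v∉S
  with minDegree G ≤? ∣ N H v ∩ S ∣
... | yes δ≤ = δ≤
... | no  δ≰ = contradiction (S-maximum (S ∪ ⁅ v ⁆) (δ≰ ∘ copy-in-S∪⁅v⁆⇒minDegree≤∣N∩S∣ G H S-free))
                             (<⇒≱ (p⊂q⇒∣p∣<∣q∣ S⊂S∪⁅v⁆))
  where
  S⊂S∪⁅v⁆ : S ⊂ S ∪ ⁅ v ⁆
  S⊂S∪⁅v⁆ = p⊆p∪q ⁅ v ⁆ , v , x∈p∪q⁺ (inj₂ (x∈⁅x⁆ v)) , v∉S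

maximum-GFree⇒∣N∩S∣-between-degrees : ∀ {m n} (G : Graph m) (H : Graph n) {S v} →
  MaximumGFree G H S → v ∉ S → minDegree G ≤ ∣ N H v ∩ S ∣ × ∣ N H v ∩ S ∣ ≤ maxDegree H
maximum-GFree⇒∣N∩S∣-between-degrees G H {S} {v} S-max v∉S =
  maximum-GFree⇒minDegree≤∣N∩S∣ G H S-max v∉S , ≤-trans (∣p∩q∣≤∣p∣ (N H v) S) (degree≤maxDegree H v)

theorem5 : ∀ {m n : ℕ} (G : Graph m) (H : Graph n) (S : Subset n) →
    MaximumGFree G H S →
    (minDegree G * (n ∸ ∣ S ∣) ≤ weightedCount H S (minDegree G) (maxDegree H))
    × (weightedCount H S (minDegree G) (maxDegree H) ≤ maxDegree H * (n ∸ ∣ S ∣))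
theorem5 {n = n} G H S S-max = lower , upper
  where
  open ≤-Reasoning
  δ = minDegree G
  Δ = maxDegree H
  ∉S : Fin n → Bool
  ∉S v = not ⌊ v ∈? S ⌋
  d : Fin n → ℕ
  d v = ∣ N H v ∩ S ∣
  d-in-range : ∀ v → T (∉S v) → δ ≤ d v × d v ≤ Δ
  d-in-range v = maximum-GFree⇒∣N∩S∣-between-degrees G H S-max ∘ toWitnessFalse
  weighted≡∑ = sumFromTo-fibres δ Δ ∉S d d-in-range
  lower = begin
    δ * (n ∸ ∣ S ∣)                         ≡⟨ ∑-const*indicator-∉ δ S ⟨
    ∑[ v < n ] (δ * indicator (∉S v))       ≤⟨ ∑-weighted-mono ∉S (λ v → proj₁ ∘ d-in-range v) ⟩
    ∑[ v < n ] (d v * indicator (∉S v))     ≡⟨ weighted≡∑ ⟨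
    weightedCount H S δ Δ                   ∎
  upper = begin
    weightedCount H S δ Δ                   ≡⟨ weighted≡∑ ⟩
    ∑[ v < n ] (d v * indicator (∉S v))     ≤⟨ ∑-weighted-mono ∉S (λ v → proj₂ ∘ d-in-range v) ⟩
    ∑[ v < n ] (Δ * indicator (∉S v))       ≡⟨ ∑-const*indicator-∉ Δ S ⟩
    Δ * (n ∸ ∣ S ∣)                         ∎
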